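{- Let $l\geq 1$ and let $G=G(m_1,\dots,m_l;\,n_1,\dots,n_l)$ be a chain graph. Then $$\sum_{i=1}^{l}m_i+n_1\leq \lambda(G)\leq \sum_{i=1}^{l}m_i+n_1+\sum_{i=1}^{l-1}(n_{i+1}-m_{l+1-i}).$$ If $n_{i+1}>m_{l+1-i}$ for all $1\leq i\leq l-1$, then the upper bound is attained, and if $n_{i+1}\leq m_{l+1-i}$ for all $1\leq i\leq l-1$, then the lower bound is attained.
   Context: $G(m_1,\dots,m_l;\,n_1,\dots,n_l)$ denotes the bipartite (chain) graph with color classes $U=U_1\cup\cdots\cup U_l$ and $V=V_1\cup\cdots\cup V_l$ (disjoint nonempty cells) with $|U_i|=m_i$, $|V_i|=n_i$, in which the neighbourhood of each vertex of $U_i$ is exactly $V_1\cup\cdots\cup V_{l+1-i}$. An $L(2,1)$-coloring of a graph is a function $f$ from its vertex set to the nonnegative integers with $|f(x)-f(y)|\geq 2$ for adjacent $x,y$ and $|f(x)-f(y)|\geq 1$ for $x,y$ at distance two; its span is $\max f-\min f$, and the $\lambda$-chromatic number $\lambda(G)$ is the minimum span over all $L(2,1)$-colorings of $G$. -}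

module Defs where

open import Data.Nat using (ℕ; zero; suc; _+_; _∸_; _≤_; _<_)
open import Data.Fin as Fin using (Fin; toℕ; inject₁; opposite)
open import Data.Product using (Σ; _×_; ∃; _,_)
open import Data.Sum using (_⊎_; inj₁; inj₂)
open import Data.Empty using (⊥)
open import Relation.Nullary using (¬_)
open import Relation.Binary.PropositionalEquality using (_≡_)

Dist2 : {V : Set} → (V → V → Set) → V → V → Set
Dist2 {V} Adj x y = ¬ (x ≡ y) × ¬ Adj x y × Σ V (λ z → Adj x z × Adj z y)

absDiff : ℕ → ℕ → ℕ
absDiff a b = (a ∸ b) + (b ∸ a)

IsL21 : {V : Set} → (V → V → Set) → (V → ℕ) → Set
IsL21 {V} Adj f =
  (∀ x y → Adj x y → 2 ≤ absDiff (f x) (f y)) ×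
  (∀ x y → Dist2 Adj x y → 1 ≤ absDiff (f x) (f y))

HasSpan : {V : Set} → (V → ℕ) → ℕ → Set
HasSpan {V} f s = Σ V (λ a → Σ V (λ b →
  (∀ v → f a ≤ f v × f v ≤ f b) × (f b ∸ f a ≡ s)))

IsLambda : {V : Set} → (V → V → Set) → ℕ → Set
IsLambda {V} Adj k =
  Σ (V → ℕ) (λ f → IsL21 Adj f × HasSpan f k) ×
  (∀ (f : V → ℕ) s → IsL21 Adj f → HasSpan f s → k ≤ s)

-- Chain graph G(m_1..m_l; n_1..n_l) with l = suc k, cells indexed 0..k.

ChainV : {k : ℕ} → (Fin (suc k) → ℕ) → (Fin (suc k) → ℕ) → Set
ChainV m n = Σ (Fin _) (λ i → Fin (m i)) ⊎ Σ (Fin _) (λ j → Fin (n j))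

-- vertex of U_i (0-based) adjacent to vertex of V_j iff j ≤ l-1-i, i.e. i + j ≤ k
ChainAdj : {k : ℕ} → (m n : Fin (suc k) → ℕ) → ChainV m n → ChainV m n → Set
ChainAdj {k} m n (inj₁ (i , _)) (inj₂ (j , _)) = toℕ i + toℕ j ≤ k
ChainAdj {k} m n (inj₂ (j , _)) (inj₁ (i , _)) = toℕ i + toℕ j ≤ k
ChainAdj m n (inj₁ _) (inj₁ _) = ⊥
ChainAdj m n (inj₂ _) (inj₂ _) = ⊥

∑ : (k : ℕ) → (Fin k → ℕ) → ℕ
∑ zero f = 0
∑ (suc k) f = f Fin.zero + ∑ k (λ i → f (Fin.suc i))

-- 0-based index of m_{l+1-i} for 1-based i = i'+1 (i' : Fin k): k - i'
oppIdx : {k : ℕ} → Fin k → Fin (suc k)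
oppIdx i = opposite (inject₁ i)

-- Every vertex of U is adjacent to every vertex of V₁, and two vertices on the same side
-- of this biclique are at distance two, so an L(2,1)-coloring uses |U| + n₁ distinct labels
-- on U ∪ V₁; as labels on opposite sides differ by at least 2, one more value between them
-- stays unused, whence span ≥ Σ mᵢ + n₁.  The same argument on U₁ ∪ V gives span ≥ m₁ + Σ nᵢ,
-- which is the upper bound when every n_{i+1} > m_{l+1−i}.
-- For the upper bound cut the labels into l + 1 consecutive blocks: V_i starts block i − 1 and
-- U_i starts one past the start of block l + 1 − i.  As U_i ~ V_j iff i + j ≤ l + 1, adjacent
-- vertices lie in different blocks, the one in V earlier, so their labels differ by at least 2.
-- λ(G) exists at all because whether a coloring of a given span exists is a finite search.
module Submission where

open import Algebra.Properties.CommutativeSemigroup using (interchange)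
open import Data.Empty using (⊥-elim)
open import Data.Fin as F using (Fin; toℕ; fromℕ<; splitAt)
import Data.Fin.Properties as FP
open import Data.Nat using (ℕ; zero; suc; _+_; _∸_; _≤_; _<_; _^_; z≤n; s≤s; s≤s⁻¹; _≤?_)
open import Data.Nat.Properties
open import Data.Nat.Solver using (module +-*-Solver)
open import Data.Product using (Σ; _×_; ∃; _,_; proj₁; proj₂)
open import Data.Sum using (_⊎_; inj₁; inj₂; [_,_]′)
open import Data.Sum.Function.Propositional using (_⊎-↔_)
open import Data.Sum.Properties using (inj₁-injective; inj₂-injective)
open import Data.Vec.Functional using (_∷_; _++_)
open import Function using (_∘_; _↔_; Inverse; Injection; mk↔ₛ′)
open import Function.Definitions using (Injective)
open import Function.Properties.Inverse using (↔-refl; ↔-trans; ↔⇒↣)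
open import Relation.Binary.Definitions using (tri<; tri≈; tri>)
open import Relation.Binary.PropositionalEquality
open import Relation.Nullary using (¬_; Dec; yes; no; ¬?)
open import Relation.Nullary.Decidable using (map′; _×-dec_; _→-dec_; decidable-stable)

open import Defs

absDiff-comm : ∀ a b → absDiff a b ≡ absDiff b a
absDiff-comm a b = +-comm (a ∸ b) (b ∸ a)

+-≤⇒≤-absDiff : ∀ {a b d} → a + d ≤ b → d ≤ absDiff a b
+-≤⇒≤-absDiff {a} {b} {d} a+d≤b =
  ≤-trans (subst (_≤ b ∸ a) (m+n∸m≡n a d) (∸-monoˡ-≤ a a+d≤b)) (m≤n+m (b ∸ a) (a ∸ b))

≤-absDiff⇒+-≤ : ∀ {a b d} → d ≤ absDiff a b → a + d ≤ b ⊎ b + d ≤ a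
≤-absDiff⇒+-≤ {a} {b} {d} d≤ with ≤-total a b
... | inj₁ a≤b = inj₁ (≤-trans (+-monoʳ-≤ a (subst (d ≤_) (cong (_+ (b ∸ a)) (m≤n⇒m∸n≡0 a≤b)) d≤))
                                (≤-reflexive (m+[n∸m]≡n a≤b)))
... | inj₂ b≤a = inj₂ (≤-trans (+-monoʳ-≤ b (subst (d ≤_) (trans (cong ((a ∸ b) +_) (m≤n⇒m∸n≡0 b≤a)) (+-identityʳ _)) d≤))
                                (≤-reflexive (m+[n∸m]≡n b≤a)))

1≤absDiff⇒≢ : ∀ {a b} → 1 ≤ absDiff a b → a ≢ b
1≤absDiff⇒≢ {a} 1≤ refl with subst (1 ≤_) (cong (λ x → x + x) (n∸n≡0 a)) 1≤
... | ()

≢⇒1≤absDiff : ∀ {a b} → a ≢ b → 1 ≤ absDiff a b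
≢⇒1≤absDiff {a} {b} a≢b with <-cmp a b
... | tri< a<b _ _ = +-≤⇒≤-absDiff (subst (_≤ b) (+-comm 1 a) a<b)
... | tri≈ _ a≡b _ = ⊥-elim (a≢b a≡b)
... | tri> _ _ b<a = subst (1 ≤_) (absDiff-comm b a) (+-≤⇒≤-absDiff (subst (_≤ a) (+-comm 1 b) b<a))

absDiff-∸ : ∀ {lo a b} → lo ≤ a → lo ≤ b → absDiff (a ∸ lo) (b ∸ lo) ≡ absDiff a b
absDiff-∸ {lo} {a} {b} lo≤a lo≤b = cong₂ _+_ (∸-∸-cancel a lo≤b) (∸-∸-cancel b lo≤a)
  where
  ∸-∸-cancel : ∀ x {y} → lo ≤ y → (x ∸ lo) ∸ (y ∸ lo) ≡ x ∸ y
  ∸-∸-cancel x lo≤y = trans (∸-+-assoc x lo _) (cong (x ∸_) (m+[n∸m]≡n lo≤y))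

injective⇒≤-width : ∀ {N lo hi} {c : Fin N → ℕ} → Injective _≡_ _≡_ c →
                    (∀ i → lo ≤ c i × c i ≤ hi) → N ≤ suc (hi ∸ lo)
injective⇒≤-width {N} {lo} {hi} {c} c-inj bounds = FP.injective⇒≤ pos-inj
  where
  pos : Fin N → Fin (suc (hi ∸ lo))
  pos i = fromℕ< (s≤s (∸-monoˡ-≤ lo (proj₂ (bounds i))))
  pos-inj : Injective _≡_ _≡_ pos
  pos-inj {i} {j} eq = c-inj (∸-cancelʳ-≡ (proj₁ (bounds i)) (proj₁ (bounds j))
                                (FP.fromℕ<-injective _ _ _ _ eq))

module _ {p q : ℕ} (a : Fin p → ℕ) (b : Fin q → ℕ) where

  ++-all : {P : ℕ → Set} → (∀ i → P (a i)) → (∀ j → P (b j)) → ∀ i → P ((a ++ b) i)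
  ++-all Pa Pb i with splitAt p i
  ... | inj₁ i′ = Pa i′
  ... | inj₂ j′ = Pb j′

  ++-injective : Injective _≡_ _≡_ a → Injective _≡_ _≡_ b → (∀ i j → a i ≢ b j) →
                 Injective _≡_ _≡_ (a ++ b)
  ++-injective a-inj b-inj a≢b {i} {j} eq =
    trans (sym (FP.join-splitAt p q i))
      (trans (cong (F.join p q) (split-inj (splitAt p i) (splitAt p j) eq)) (FP.join-splitAt p q j))
    where
    split-inj : ∀ x y → [ a , b ]′ x ≡ [ a , b ]′ y → x ≡ y
    split-inj (inj₁ x) (inj₁ y) e = cong inj₁ (a-inj e)
    split-inj (inj₁ x) (inj₂ y) e = ⊥-elim (a≢b x y e)
    split-inj (inj₂ x) (inj₁ y) e = ⊥-elim (a≢b y x (sym e))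
    split-inj (inj₂ x) (inj₂ y) e = cong inj₂ (b-inj e)

∷-injective : ∀ {N x} {c : Fin N → ℕ} → (∀ i → c i ≢ x) → Injective _≡_ _≡_ c →
              Injective _≡_ _≡_ (x ∷ c)
∷-injective x∉c c-inj {F.zero}  {F.zero}  _  = refl
∷-injective x∉c c-inj {F.zero}  {F.suc j} eq = ⊥-elim (x∉c j (sym eq))
∷-injective x∉c c-inj {F.suc i} {F.zero}  eq = ⊥-elim (x∉c i eq)
∷-injective x∉c c-inj {F.suc i} {F.suc j} eq = cong F.suc (c-inj eq)

argmax : ∀ {p} (f : Fin p → ℕ) → Fin p → ∃ λ i → ∀ j → f j ≤ f i
argmax {suc zero} f _ = F.zero , λ { F.zero → ≤-refl }
argmax {suc (suc p)} f _ with argmax (λ i → f (F.suc i)) F.zero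
... | i , f≤ with f F.zero ≤? f (F.suc i)
...   | yes f₀≤ = F.suc i , λ { F.zero → f₀≤ ; (F.suc j) → f≤ j }
...   | no f₀≰ = F.zero , λ { F.zero → ≤-refl ; (F.suc j) → ≤-trans (f≤ j) (<⇒≤ (≰⇒> f₀≰)) }

module _ {p q : ℕ} where

  Separated : (Fin p → ℕ) → (Fin q → ℕ) → Set
  Separated a b = ∀ i j → 2 ≤ absDiff (a i) (b j)

  Gap : (Fin p → ℕ) → (Fin q → ℕ) → ℕ → ℕ → Set
  Gap a b lo hi = ∃ λ x → (lo ≤ x × x ≤ hi) × (∀ i → a i ≢ x) × (∀ j → b j ≢ x)

  gap-above-max : ∀ {a : Fin p → ℕ} {b : Fin q → ℕ} {lo hi} i* j → Separated a b →
                  (∀ i → a i ≤ a i*) → lo ≤ a i* → a i* + 2 ≤ b j → b j ≤ hi → Gap a b lo hi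
  gap-above-max {a} {b} i* j sep a≤a* lo≤a* a*+2≤bⱼ bⱼ≤hi =
    suc (a i*) , (≤-trans lo≤a* (n≤1+n _) , ≤-trans a*<bⱼ bⱼ≤hi) , a-free , b-free
    where
    a*<bⱼ : a i* < b j
    a*<bⱼ = m+n≤o⇒m≤o (suc (a i*)) (subst (_≤ b j) (+-suc (a i*) 1) a*+2≤bⱼ)
    a-free : ∀ i → a i ≢ suc (a i*)
    a-free i e = 1+n≰n (subst (_≤ a i*) e (a≤a* i))
    b-free : ∀ j′ → b j′ ≢ suc (a i*)
    b-free j′ e with ≤-absDiff⇒+-≤ (subst (λ y → 2 ≤ absDiff (a i*) y) e (sep i* j′))
    ... | inj₁ a*+2≤ = m+1+n≰m (a i*) (s≤s⁻¹ (subst (_≤ suc (a i*)) (+-suc (a i*) 1) a*+2≤))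
    ... | inj₂ ≤a*   = 1+n≰n (m+n≤o⇒m≤o (suc (a i*)) ≤a*)

Separated-sym : ∀ {p q} {a : Fin p → ℕ} {b : Fin q → ℕ} → Separated a b → Separated b a
Separated-sym {a = a} {b} sep j i = subst (2 ≤_) (absDiff-comm (a i) (b j)) (sep i j)

separated-gap : ∀ {p q lo hi} {a : Fin p → ℕ} {b : Fin q → ℕ} → Fin p → Fin q → Separated a b →
                (∀ i → lo ≤ a i × a i ≤ hi) → (∀ j → lo ≤ b j × b j ≤ hi) → Gap a b lo hi
separated-gap {a = a} {b} i₀ j₀ sep a-bd b-bd with argmax a i₀ | argmax b j₀
... | i* , a≤a* | j* , b≤b* with ≤-absDiff⇒+-≤ (sep i* j*)
...   | inj₁ a*+2≤b* = gap-above-max {a = a} {b} i* j* sep a≤a* (proj₁ (a-bd i*)) a*+2≤b* (proj₂ (b-bd j*))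
...   | inj₂ b*+2≤a*
  with gap-above-max {a = b} {a} j* i* (Separated-sym {a = a} {b} sep) b≤b*
                     (proj₁ (b-bd j*)) b*+2≤a* (proj₂ (a-bd i*))
...     | x , x∈ , b-free , a-free = x , x∈ , a-free , b-free

-- The two families together with a gap give p + q + 1 distinct labels in [lo, hi].
separated-families-bound : ∀ {p q lo hi} {a : Fin p → ℕ} {b : Fin q → ℕ} → Fin p → Fin q →
                           Injective _≡_ _≡_ a → Injective _≡_ _≡_ b → Separated a b →
                           (∀ i → lo ≤ a i × a i ≤ hi) → (∀ j → lo ≤ b j × b j ≤ hi) →
                           p + q ≤ hi ∸ lo
separated-families-bound {p} {q} {lo} {hi} {a} {b} i₀ j₀ a-inj b-inj sep a-bd b-bd =
  count (separated-gap i₀ j₀ sep a-bd b-bd)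
  where
  a≢b : ∀ i j → a i ≢ b j
  a≢b i j = 1≤absDiff⇒≢ (≤-trans (n≤1+n 1) (sep i j))
  count : Gap a b lo hi → p + q ≤ hi ∸ lo
  count (x , x∈ , a-free , b-free) = s≤s⁻¹ (injective⇒≤-width
    (∷-injective (++-all a b {_≢ x} a-free b-free) (++-injective a b a-inj b-inj a≢b))
    λ { F.zero → x∈ ; (F.suc i) → ++-all a b {λ y → lo ≤ y × y ≤ hi} a-bd b-bd i })

least-satisfying : ∀ {P : ℕ → Set} → (∀ n → Dec (P n)) → ∀ {u} → P u →
                   ∃ λ s → P s × (∀ t → P t → s ≤ t)
least-satisfying {P} P? {u} pu with FP.¬∀⟶∃¬-smallest (suc u) (λ i → ¬ P (toℕ i)) (λ i → ¬? (P? (toℕ i)))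
                                     (λ ∀¬P → ∀¬P (F.fromℕ u) (subst P (sym (FP.toℕ-fromℕ u)) pu))
... | i , ¬¬pi , below = toℕ i , decidable-stable (P? (toℕ i)) ¬¬pi , minimal
  where
  minimal : ∀ t → P t → toℕ i ≤ t
  minimal t pt = ≮⇒≥ λ t<i → below (fromℕ< t<i)
    (subst P (sym (trans (FP.toℕ-inject (fromℕ< t<i)) (FP.toℕ-fromℕ< t<i))) pt)

HasSpan-cong : ∀ {V : Set} {f g : V → ℕ} {s} → (∀ v → f v ≡ g v) → HasSpan f s → HasSpan g s
HasSpan-cong f≗g (lo , hi , bounded , span) =
  lo , hi , (λ v → subst₂ _≤_ (f≗g lo) (f≗g v) (proj₁ (bounded v)) ,
                   subst₂ _≤_ (f≗g v) (f≗g hi) (proj₂ (bounded v))) ,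
  subst₂ (λ b a → b ∸ a ≡ _) (f≗g hi) (f≗g lo) span

module _ {V : Set} (Adj : V → V → Set) where

  IsL21-cong : ∀ {f g} → (∀ v → f v ≡ g v) → IsL21 Adj f → IsL21 Adj g
  IsL21-cong f≗g (adj-sep , d2-sep) =
    (λ x y xy → subst₂ (λ u w → 2 ≤ absDiff u w) (f≗g x) (f≗g y) (adj-sep x y xy)) ,
    (λ x y xy → subst₂ (λ u w → 1 ≤ absDiff u w) (f≗g x) (f≗g y) (d2-sep x y xy))

  IsL21-∸ : ∀ {f lo} → (∀ v → lo ≤ f v) → IsL21 Adj f → IsL21 Adj (λ v → f v ∸ lo)
  IsL21-∸ lo≤ (adj-sep , d2-sep) =
    (λ x y xy → subst (2 ≤_) (sym (absDiff-∸ (lo≤ x) (lo≤ y))) (adj-sep x y xy)) ,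
    (λ x y xy → subst (1 ≤_) (sym (absDiff-∸ (lo≤ x) (lo≤ y))) (d2-sep x y xy))

  common-neighbour⇒injective : ∀ {r f} → IsL21 Adj f → (Z : Fin r → V) → Injective _≡_ _≡_ Z →
                               (∀ i i′ → ¬ Adj (Z i) (Z i′)) →
                               ∀ w → (∀ i → Adj (Z i) w) → (∀ i → Adj w (Z i)) →
                               Injective _≡_ _≡_ (f ∘ Z)
  common-neighbour⇒injective (_ , d2-sep) Z Z-inj indep w Z→w w→Z {i} {i′} fZi≡fZi′
    with i F.≟ i′
  ... | yes i≡i′ = i≡i′
  ... | no  i≢i′ = ⊥-elim (1≤absDiff⇒≢ (d2-sep _ _ dist2) fZi≡fZi′)
    where
    dist2 : Dist2 Adj (Z i) (Z i′)
    dist2 = i≢i′ ∘ Z-inj , indep i i′ , w , Z→w i , w→Z i′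

  biclique-span-bound : ∀ {p q f s} (X : Fin p → V) (Y : Fin q → V) → Fin p → Fin q →
                        Injective _≡_ _≡_ X → Injective _≡_ _≡_ Y →
                        (∀ i i′ → ¬ Adj (X i) (X i′)) → (∀ j j′ → ¬ Adj (Y j) (Y j′)) →
                        (∀ i j → Adj (X i) (Y j)) → (∀ i j → Adj (Y j) (X i)) →
                        IsL21 Adj f → HasSpan f s → p + q ≤ s
  biclique-span-bound {f = f} X Y i₀ j₀ X-inj Y-inj X-indep Y-indep X→Y Y→X l21 (lo , hi , bounded , span) =
    subst (_ ≤_) span (separated-families-bound {a = f ∘ X} {b = f ∘ Y} i₀ j₀
      (common-neighbour⇒injective {f = f} l21 X X-inj X-indep (Y j₀) (λ i → X→Y i j₀) (λ i → Y→X i j₀))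
      (common-neighbour⇒injective {f = f} l21 Y Y-inj Y-indep (X i₀) (Y→X i₀) (X→Y i₀))
      (λ i j → proj₁ l21 _ _ (X→Y i j))
      (λ _ → bounded _) (λ _ → bounded _))

  Colorable : ℕ → Set
  Colorable s = ∃ λ f → IsL21 Adj f × HasSpan f s

  Colorable-normalised : ∀ {s} → Colorable s →
                         ∃ λ f → (IsL21 Adj f × HasSpan f s) × (∀ v → f v < suc s)
  Colorable-normalised {s} (f , l21 , lo , hi , bounded , span) =
    (λ v → f v ∸ f lo) ,
    (IsL21-∸ (proj₁ ∘ bounded) l21 ,
     lo , hi , (λ v → ∸-monoˡ-≤ (f lo) (proj₁ (bounded v)) , ∸-monoˡ-≤ (f lo) (proj₂ (bounded v))) ,
     trans (cong (f hi ∸ f lo ∸_) (n∸n≡0 (f lo))) span) ,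
    λ v → s≤s (subst (f v ∸ f lo ≤_) span (∸-monoˡ-≤ (f lo) (proj₂ (bounded v))))

  IsLambda-≤ : ∀ {Λ s} → IsLambda Adj Λ → Colorable s → Λ ≤ s
  IsLambda-≤ (_ , minimal) (f , l21 , span) = minimal f _ l21 span

  module MinimalSpan {N : ℕ} (adj? : ∀ x y → Dec (Adj x y)) (enum : Fin N ↔ V) where

    open Inverse enum using (to; from; strictlyInverseˡ)

    all? : {P : V → Set} → (∀ v → Dec (P v)) → Dec (∀ v → P v)
    all? {P} P? = map′ (λ ∀P v → subst P (strictlyInverseˡ v) (∀P (from v))) (λ ∀P → ∀P ∘ to)
                       (FP.all? (P? ∘ to))

    any? : {P : V → Set} → (∀ v → Dec (P v)) → Dec (∃ P)
    any? {P} P? = map′ (λ (i , p) → to i , p) (λ (v , p) → from v , subst P (sym (strictlyInverseˡ v)) p)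
                       (FP.any? (P? ∘ to))

    _≟ᵥ_ : (x y : V) → Dec (x ≡ y)
    x ≟ᵥ y = map′ (λ e → trans (sym (strictlyInverseˡ x)) (trans (cong to e) (strictlyInverseˡ y)))
                 (cong from) (from x F.≟ from y)

    dist2? : ∀ x y → Dec (Dist2 Adj x y)
    dist2? x y = ¬? (x ≟ᵥ y) ×-dec ¬? (adj? x y) ×-dec any? (λ z → adj? x z ×-dec adj? z y)

    isL21? : ∀ f → Dec (IsL21 Adj f)
    isL21? f = all? (λ x → all? λ y → adj? x y →-dec 2 ≤? absDiff (f x) (f y))
        ×-dec all? (λ x → all? λ y → dist2? x y →-dec 1 ≤? absDiff (f x) (f y))

    hasSpan? : ∀ f s → Dec (HasSpan f s)
    hasSpan? f s = any? λ a → any? λ b →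
      all? (λ v → (f a ≤? f v) ×-dec (f v ≤? f b)) ×-dec (f b ∸ f a ≟ s)

    -- A coloring of span s may be assumed to take values in Fin (suc s), and
    -- those colorings are enumerated by Fin (suc s ^ N).
    colorable? : ∀ s → Dec (Colorable s)
    colorable? s = map′ (λ (c , q) → decode c , q) encode
                        (FP.any? λ c → isL21? (decode c) ×-dec hasSpan? (decode c) s)
      where
      decode : Fin (suc s ^ N) → V → ℕ
      decode c v = toℕ (F.finToFun c (from v))
      encode : Colorable s → ∃ λ c → IsL21 Adj (decode c) × HasSpan (decode c) s
      encode cs with Colorable-normalised cs
      ... | f , (l21 , span) , f< = c , IsL21-cong f≗ l21 , HasSpan-cong f≗ span
        where
        c : Fin (suc s ^ N)
        c = F.funToFin (λ i → fromℕ< (f< (to i)))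
        f≗ : ∀ v → f v ≡ decode c v
        f≗ v = begin
          f v                              ≡⟨ cong f (strictlyInverseˡ v) ⟨
          f (to (from v))                  ≡⟨ FP.toℕ-fromℕ< _ ⟨
          toℕ (fromℕ< (f< (to (from v))))  ≡⟨ cong toℕ (FP.finToFun-funToFin _ (from v)) ⟨
          toℕ (F.finToFun c (from v))      ∎
          where open ≡-Reasoning

    lambda-exists : ∀ {u} → Colorable u → ∃ (IsLambda Adj)
    lambda-exists cu = least⇒IsLambda (least-satisfying colorable? cu)
      where
      least⇒IsLambda : (∃ λ s → Colorable s × (∀ t → Colorable t → s ≤ t)) → ∃ (IsLambda Adj)
      least⇒IsLambda (s , cs , minimal) = s , cs , λ f t l21 span → minimal t (f , l21 , span)

∑-cong : ∀ {N} {f g : Fin N → ℕ} → (∀ i → f i ≡ g i) → ∑ N f ≡ ∑ N g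
∑-cong {zero}  f≗g = refl
∑-cong {suc N} f≗g = cong₂ _+_ (f≗g F.zero) (∑-cong (f≗g ∘ F.suc))

∑-zero : ∀ N → ∑ N (λ _ → 0) ≡ 0
∑-zero zero    = refl
∑-zero (suc N) = ∑-zero N

∑-distrib-+ : ∀ N (f g : Fin N → ℕ) → ∑ N (λ i → f i + g i) ≡ ∑ N f + ∑ N g
∑-distrib-+ zero    f g = refl
∑-distrib-+ (suc N) f g =
  trans (cong (f F.zero + g F.zero +_) (∑-distrib-+ N (f ∘ F.suc) (g ∘ F.suc)))
        (interchange +-commutativeSemigroup (f F.zero) (g F.zero) _ _)

∑-init-last : ∀ N (f : Fin (suc N) → ℕ) → ∑ (suc N) f ≡ ∑ N (f ∘ F.inject₁) + f (F.fromℕ N)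
∑-init-last zero    f = +-comm (f F.zero) 0
∑-init-last (suc N) f = trans (cong (f F.zero +_) (∑-init-last N (f ∘ F.suc))) (sym (+-assoc (f F.zero) _ _))

∑-reverse : ∀ N (f : Fin N → ℕ) → ∑ N (f ∘ F.opposite) ≡ ∑ N f
∑-reverse zero    f = refl
∑-reverse (suc N) f = begin
  f (F.fromℕ N) + ∑ N (f ∘ F.inject₁ ∘ F.opposite) ≡⟨ cong (f (F.fromℕ N) +_) (∑-reverse N (f ∘ F.inject₁)) ⟩
  f (F.fromℕ N) + ∑ N (f ∘ F.inject₁)             ≡⟨ +-comm (f (F.fromℕ N)) _ ⟩
  ∑ N (f ∘ F.inject₁) + f (F.fromℕ N)             ≡⟨ ∑-init-last N f ⟨
  ∑ (suc N) f                                     ∎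
  where open ≡-Reasoning

offset : ∀ {N} → (Fin N → ℕ) → Fin N → ℕ
offset w F.zero    = 0
offset w (F.suc i) = w F.zero + offset (w ∘ F.suc) i

offset-+-≤-∑ : ∀ {N} (w : Fin N → ℕ) i → offset w i + w i ≤ ∑ N w
offset-+-≤-∑ w F.zero    = m≤m+n (w F.zero) _
offset-+-≤-∑ w (F.suc i) = ≤-trans (≤-reflexive (+-assoc (w F.zero) _ _)) (+-monoʳ-≤ (w F.zero) (offset-+-≤-∑ (w ∘ F.suc) i))

offset-+-≤-offset : ∀ {N} (w : Fin N → ℕ) {i j} → toℕ i < toℕ j → offset w i + w i ≤ offset w j
offset-+-≤-offset w {F.zero}  {F.suc j} _       = m≤m+n (w F.zero) _
offset-+-≤-offset w {F.suc i} {F.suc j} (s≤s i<j) =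
  ≤-trans (≤-reflexive (+-assoc (w F.zero) _ _)) (+-monoʳ-≤ (w F.zero) (offset-+-≤-offset (w ∘ F.suc) i<j))

offset-+-fromℕ : ∀ N (w : Fin (suc N) → ℕ) → offset w (F.fromℕ N) + w (F.fromℕ N) ≡ ∑ (suc N) w
offset-+-fromℕ zero    w = +-comm 0 (w F.zero)
offset-+-fromℕ (suc N) w = trans (+-assoc (w F.zero) _ _) (cong (w F.zero +_) (offset-+-fromℕ N (w ∘ F.suc)))

offset-+-<-offset-+ : ∀ {N} (w : Fin N → ℕ) {i j a} b → toℕ i < toℕ j → a < w i →
                      offset w i + a < offset w j + b
offset-+-<-offset-+ w {i} {j} b i<j a<wᵢ =
  ≤-trans (+-monoʳ-< (offset w i) a<wᵢ) (≤-trans (offset-+-≤-offset w i<j) (m≤m+n _ b))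

offset-+-injective : ∀ {N} (w : Fin N → ℕ) {i j a b} → a < w i → b < w j →
                     offset w i + a ≡ offset w j + b → i ≡ j × a ≡ b
offset-+-injective w {i} {j} {a} {b} a<wᵢ b<wⱼ eq with <-cmp (toℕ i) (toℕ j)
... | tri< i<j _ _ = ⊥-elim (<⇒≢ (offset-+-<-offset-+ w b i<j a<wᵢ) eq)
... | tri> _ _ j<i = ⊥-elim (<⇒≢ (offset-+-<-offset-+ w a j<i b<wⱼ) (sym eq))
... | tri≈ _ i≡j _ with FP.toℕ-injective i≡j
...   | refl = refl , +-cancelˡ-≡ (offset w i) a b eq

⊎↔Σ-Fin-suc : ∀ {N} (c : Fin (suc N) → ℕ) →
              (Fin (c F.zero) ⊎ Σ (Fin N) (Fin ∘ c ∘ F.suc)) ↔ Σ (Fin (suc N)) (Fin ∘ c)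
⊎↔Σ-Fin-suc {N} c = mk↔ₛ′ to from (λ { (F.zero , _) → refl ; (F.suc _ , _) → refl })
                                    (λ { (inj₁ _) → refl ; (inj₂ _) → refl })
  where
  to : Fin (c F.zero) ⊎ Σ (Fin N) (Fin ∘ c ∘ F.suc) → Σ (Fin (suc N)) (Fin ∘ c)
  to (inj₁ a)       = F.zero , a
  to (inj₂ (i , a)) = F.suc i , a
  from : Σ (Fin (suc N)) (Fin ∘ c) → Fin (c F.zero) ⊎ Σ (Fin N) (Fin ∘ c ∘ F.suc)
  from (F.zero , a)  = inj₁ a
  from (F.suc i , a) = inj₂ (i , a)

cells↔ : ∀ {N} (c : Fin N → ℕ) → Fin (∑ N c) ↔ Σ (Fin N) (Fin ∘ c)
cells↔ {zero}  c = mk↔ₛ′ (λ ()) (λ { (() , _) }) (λ { (() , _) }) (λ ())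
cells↔ {suc N} c = ↔-trans FP.+↔⊎ (↔-trans (↔-refl ⊎-↔ cells↔ (c ∘ F.suc)) (⊎↔Σ-Fin-suc c))

padLast : ∀ {N} → (Fin N → ℕ) → Fin (suc N) → ℕ
padLast {zero}  f F.zero    = 0
padLast {suc N} f F.zero    = f F.zero
padLast {suc N} f (F.suc i) = padLast (f ∘ F.suc) i

padLast-inject₁ : ∀ {N} (f : Fin N → ℕ) i → padLast f (F.inject₁ i) ≡ f i
padLast-inject₁ f F.zero    = refl
padLast-inject₁ f (F.suc i) = padLast-inject₁ (f ∘ F.suc) i

padLast-fromℕ : ∀ N (f : Fin N → ℕ) → padLast f (F.fromℕ N) ≡ 0
padLast-fromℕ zero    f = refl
padLast-fromℕ (suc N) f = padLast-fromℕ N (f ∘ F.suc)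

opposite-fromℕ : ∀ N → F.opposite (F.fromℕ N) ≡ F.zero
opposite-fromℕ N = FP.toℕ-injective (trans (FP.opposite-prop (F.fromℕ N))
                                       (trans (cong (N ∸_) (FP.toℕ-fromℕ N)) (n∸n≡0 N)))

module ChainGraph {k : ℕ} (m n : Fin (suc k) → ℕ) where

  adj? : ∀ x y → Dec (ChainAdj m n x y)
  adj? (inj₁ (i , _)) (inj₂ (j , _)) = toℕ i + toℕ j ≤? k
  adj? (inj₂ (j , _)) (inj₁ (i , _)) = toℕ i + toℕ j ≤? k
  adj? (inj₁ _)       (inj₁ _)       = no λ ()
  adj? (inj₂ _)       (inj₂ _)       = no λ ()

  vertices↔ : Fin (∑ (suc k) m + ∑ (suc k) n) ↔ ChainV m n
  vertices↔ = ↔-trans FP.+↔⊎ (cells↔ m ⊎-↔ cells↔ n)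

  toℕ≤k : (i : Fin (suc k)) → toℕ i ≤ k
  toℕ≤k = FP.toℕ≤pred[n]

  span-≥-∑m+n₀ : 1 ≤ m F.zero → 1 ≤ n F.zero → ∀ {f s} → IsL21 (ChainAdj m n) f → HasSpan f s →
                 ∑ (suc k) m + n F.zero ≤ s
  span-≥-∑m+n₀ 1≤m₀ 1≤n₀ = biclique-span-bound (ChainAdj m n) U V₀
    (Inverse.from (cells↔ m) (F.zero , fromℕ< 1≤m₀)) (fromℕ< 1≤n₀)
    (Injection.injective (↔⇒↣ (cells↔ m)) ∘ inj₁-injective) (λ { refl → refl })
    (λ _ _ ()) (λ _ _ ()) U~V₀ U~V₀
    where
    U : Fin (∑ (suc k) m) → ChainV m n
    U = inj₁ ∘ Inverse.to (cells↔ m)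
    V₀ : Fin (n F.zero) → ChainV m n
    V₀ b = inj₂ (F.zero , b)
    U~V₀ : ∀ i j → toℕ (proj₁ (Inverse.to (cells↔ m) i)) + 0 ≤ k
    U~V₀ i j = subst (_≤ k) (sym (+-identityʳ _)) (toℕ≤k _)

  span-≥-m₀+∑n : 1 ≤ m F.zero → 1 ≤ n F.zero → ∀ {f s} → IsL21 (ChainAdj m n) f → HasSpan f s →
                 m F.zero + ∑ (suc k) n ≤ s
  span-≥-m₀+∑n 1≤m₀ 1≤n₀ = biclique-span-bound (ChainAdj m n) U₀ V
    (fromℕ< 1≤m₀) (Inverse.from (cells↔ n) (F.zero , fromℕ< 1≤n₀))
    (λ { refl → refl }) (Injection.injective (↔⇒↣ (cells↔ n)) ∘ inj₂-injective)
    (λ _ _ ()) (λ _ _ ()) U₀~V U₀~V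
    where
    U₀ : Fin (m F.zero) → ChainV m n
    U₀ a = inj₁ (F.zero , a)
    V : Fin (∑ (suc k) n) → ChainV m n
    V = inj₂ ∘ Inverse.to (cells↔ n)
    U₀~V : ∀ i j → toℕ (proj₁ (Inverse.to (cells↔ n) j)) ≤ k
    U₀~V i j = toℕ≤k _

  -- With cells indexed from 0, block b + 1 holds V_{b+1} and U_{k−b}, so it needs width
  -- max(n_{b+1}, m_{k−b}); padLast supplies n_{k+1} = 0 for the last block.
  width : Fin (suc (suc k)) → ℕ
  width F.zero    = n F.zero
  width (F.suc b) = m (F.opposite b) + (padLast (n ∘ F.suc) b ∸ m (F.opposite b))

  vBlock uBlock : Fin (suc k) → Fin (suc (suc k))
  vBlock j = F.inject₁ j
  uBlock t = F.suc (F.opposite t)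

  label : ChainV m n → ℕ
  label (inj₁ (t , a)) = suc (offset width (uBlock t) + toℕ a)
  label (inj₂ (j , b)) = offset width (vBlock j) + toℕ b

  V-fits : ∀ j (b : Fin (n j)) → toℕ b < width (vBlock j)
  V-fits F.zero    b = FP.toℕ<n b
  V-fits (F.suc j) b = ≤-trans (FP.toℕ<n b)
    (subst (_≤ width (vBlock (F.suc j))) (padLast-inject₁ (n ∘ F.suc) j)
           (m≤n+m∸n (padLast (n ∘ F.suc) (F.inject₁ j)) (m (oppIdx j))))

  U-fits : ∀ t (a : Fin (m t)) → toℕ a < width (uBlock t)
  U-fits t a = ≤-trans (FP.toℕ<n a)
    (subst (λ t′ → m t′ ≤ width (uBlock t)) (FP.opposite-involutive t) (m≤m+n _ _))

  uBlock-injective : ∀ {t t′} → uBlock t ≡ uBlock t′ → t ≡ t′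
  uBlock-injective {t} {t′} eq = begin
    t                          ≡⟨ FP.opposite-involutive t ⟨
    F.opposite (F.opposite t)  ≡⟨ cong F.opposite (FP.suc-injective eq) ⟩
    F.opposite (F.opposite t′) ≡⟨ FP.opposite-involutive t′ ⟩
    t′                         ∎
    where open ≡-Reasoning

  U-label-injective : ∀ {u u′} → label (inj₁ u) ≡ label (inj₁ u′) → u ≡ u′
  U-label-injective {t , a} {t′ , a′} eq
    with offset-+-injective width (U-fits t a) (U-fits t′ a′) (suc-injective eq)
  ... | t≡ , a≡ with uBlock-injective {t} {t′} t≡
  ...   | refl = cong (t ,_) (FP.toℕ-injective a≡)

  V-label-injective : ∀ {v v′} → label (inj₂ v) ≡ label (inj₂ v′) → v ≡ v′
  V-label-injective {j , b} {j′ , b′} eq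
    with offset-+-injective width (V-fits j b) (V-fits j′ b′) eq
  ... | j≡ , b≡ with FP.inject₁-injective {i = j} {j′} j≡
  ...   | refl = cong (j ,_) (FP.toℕ-injective b≡)

  adjacent⇒vBlock<uBlock : ∀ t j → toℕ t + toℕ j ≤ k → toℕ (vBlock j) < toℕ (uBlock t)
  adjacent⇒vBlock<uBlock t j t+j≤k = s≤s (subst₂ _≤_ (sym (FP.toℕ-inject₁ j)) (sym (FP.opposite-prop t))
    (m+n≤o⇒m≤o∸n (toℕ j) (subst (_≤ k) (+-comm (toℕ t) (toℕ j)) t+j≤k)))

  adjacent-labels : ∀ t (a : Fin (m t)) j (b : Fin (n j)) → toℕ t + toℕ j ≤ k →
                    label (inj₂ (j , b)) + 2 ≤ label (inj₁ (t , a))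
  adjacent-labels t a j b t+j≤k = subst (_≤ label (inj₁ (t , a))) (+-comm 2 (label (inj₂ (j , b))))
    (s≤s (≤-trans (offset-+-<-offset-+ width 0 (adjacent⇒vBlock<uBlock t j t+j≤k) (V-fits j b))
                  (+-monoʳ-≤ _ z≤n)))

  label-L21 : IsL21 (ChainAdj m n) label
  label-L21 = adjacent-sep , distance-two-sep
    where
    adjacent-sep : ∀ x y → ChainAdj m n x y → 2 ≤ absDiff (label x) (label y)
    adjacent-sep (inj₁ (t , a)) (inj₂ (j , b)) t+j≤k =
      subst (2 ≤_) (absDiff-comm (label (inj₂ (j , b))) (label (inj₁ (t , a))))
        (+-≤⇒≤-absDiff (adjacent-labels t a j b t+j≤k))
    adjacent-sep (inj₂ (j , b)) (inj₁ (t , a)) t+j≤k = +-≤⇒≤-absDiff (adjacent-labels t a j b t+j≤k)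
    distance-two-sep : ∀ x y → Dist2 (ChainAdj m n) x y → 1 ≤ absDiff (label x) (label y)
    distance-two-sep (inj₁ u) (inj₁ u′) (u≢u′ , _) = ≢⇒1≤absDiff (u≢u′ ∘ cong inj₁ ∘ U-label-injective)
    distance-two-sep (inj₂ v) (inj₂ v′) (v≢v′ , _) = ≢⇒1≤absDiff (v≢v′ ∘ cong inj₂ ∘ V-label-injective)
    distance-two-sep (inj₁ _) (inj₂ _) (_ , _ , inj₁ _ , () , _)
    distance-two-sep (inj₁ _) (inj₂ _) (_ , _ , inj₂ _ , _ , ())
    distance-two-sep (inj₂ _) (inj₁ _) (_ , _ , inj₁ _ , _ , ())
    distance-two-sep (inj₂ _) (inj₁ _) (_ , _ , inj₂ _ , () , _)

  width-last : width (F.fromℕ (suc k)) ≡ m F.zero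
  width-last rewrite padLast-fromℕ k (n ∘ F.suc) | opposite-fromℕ k =
    trans (cong (m F.zero +_) (0∸n≡0 (m F.zero))) (+-identityʳ (m F.zero))

  label-≤-∑width : ∀ x → label x ≤ ∑ (suc (suc k)) width
  label-≤-∑width (inj₁ (t , a)) =
    ≤-trans (subst (_≤ offset width (uBlock t) + width (uBlock t)) (+-suc (offset width (uBlock t)) (toℕ a))
                   (+-monoʳ-≤ (offset width (uBlock t)) (U-fits t a)))
            (offset-+-≤-∑ width (uBlock t))
  label-≤-∑width (inj₂ (j , b)) = ≤-trans (<⇒≤ (+-monoʳ-< _ (V-fits j b))) (offset-+-≤-∑ width (vBlock j))

  label-span : 1 ≤ m F.zero → 1 ≤ n F.zero → HasSpan label (∑ (suc (suc k)) width)
  label-span 1≤m₀ 1≤n₀ = lowest , highest ,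
    (λ v → subst (_≤ label v) (sym lowest≡0) z≤n , subst (label v ≤_) (sym highest≡∑) (label-≤-∑width v)) ,
    cong₂ _∸_ highest≡∑ lowest≡0
    where
    first : Fin (n F.zero)
    first = fromℕ< 1≤n₀
    last : ∀ {x} → 1 ≤ x → Σ (Fin x) λ a → suc (toℕ a) ≡ x
    last {suc x} _ = F.fromℕ x , cong suc (FP.toℕ-fromℕ x)
    lowest highest : ChainV m n
    lowest  = inj₂ (F.zero , first)
    highest = inj₁ (F.zero , proj₁ (last 1≤m₀))
    lowest≡0 : label lowest ≡ 0
    lowest≡0 = FP.toℕ-fromℕ< 1≤n₀
    highest≡∑ : label highest ≡ ∑ (suc (suc k)) width
    highest≡∑ = begin
      suc (offset width (F.fromℕ (suc k)) + toℕ (proj₁ (last 1≤m₀))) ≡⟨ +-suc _ _ ⟨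
      offset width (F.fromℕ (suc k)) + suc (toℕ (proj₁ (last 1≤m₀))) ≡⟨ cong (offset width (F.fromℕ (suc k)) +_) (trans (proj₂ (last 1≤m₀)) (sym width-last)) ⟩
      offset width (F.fromℕ (suc k)) + width (F.fromℕ (suc k))       ≡⟨ offset-+-fromℕ (suc k) width ⟩
      ∑ (suc (suc k)) width                                           ∎
      where open ≡-Reasoning

  excess : ℕ
  excess = ∑ k (λ i → n (F.suc i) ∸ m (oppIdx i))

  ∑width≡ : ∑ (suc (suc k)) width ≡ n F.zero + (∑ k (λ i → m (oppIdx i) + (n (F.suc i) ∸ m (oppIdx i))) + m F.zero)
  ∑width≡ = cong (n F.zero +_) (trans (∑-init-last k (width ∘ F.suc))
    (cong₂ _+_ (∑-cong λ i → cong (λ x → m (oppIdx i) + (x ∸ m (oppIdx i))) (padLast-inject₁ (n ∘ F.suc) i))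
               width-last))

  ∑m-reversed : ∑ k (m ∘ oppIdx) + m F.zero ≡ ∑ (suc k) m
  ∑m-reversed = begin
    ∑ k (m ∘ oppIdx) + m F.zero                           ≡⟨ cong (∑ k (m ∘ oppIdx) +_) (cong m (opposite-fromℕ k)) ⟨
    ∑ k (m ∘ F.opposite ∘ F.inject₁) + m (F.opposite (F.fromℕ k)) ≡⟨ ∑-init-last k (m ∘ F.opposite) ⟨
    ∑ (suc k) (m ∘ F.opposite)                           ≡⟨ ∑-reverse (suc k) m ⟩
    ∑ (suc k) m                                           ∎
    where open ≡-Reasoning

  ∑width≡∑m+n₀+excess : ∑ (suc (suc k)) width ≡ ∑ (suc k) m + n F.zero + excess
  ∑width≡∑m+n₀+excess = begin
    ∑ (suc (suc k)) width                            ≡⟨ ∑width≡ ⟩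
    n₀ + (∑ k (λ i → m (oppIdx i) + _) + m₀)         ≡⟨ cong (λ x → n₀ + (x + m₀)) (∑-distrib-+ k (m ∘ oppIdx) _) ⟩
    n₀ + (∑ k (m ∘ oppIdx) + excess + m₀)            ≡⟨ solve 4 (λ n₀ M e m₀ → n₀ :+ ((M :+ e) :+ m₀) := (M :+ m₀) :+ n₀ :+ e)
                                                             refl n₀ (∑ k (m ∘ oppIdx)) excess m₀ ⟩
    ∑ k (m ∘ oppIdx) + m₀ + n₀ + excess              ≡⟨ cong (λ x → x + n₀ + excess) ∑m-reversed ⟩
    ∑ (suc k) m + n₀ + excess                        ∎
    where
    open ≡-Reasoning
    open +-*-Solver
    m₀ = m F.zero
    n₀ = n F.zero

  ∑width≡m₀+∑n : (∀ i → m (oppIdx i) ≤ n (F.suc i)) → ∑ (suc (suc k)) width ≡ m F.zero + ∑ (suc k) n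
  ∑width≡m₀+∑n m≤n = begin
    ∑ (suc (suc k)) width                        ≡⟨ ∑width≡ ⟩
    n₀ + (∑ k (λ i → m (oppIdx i) + _) + m₀)     ≡⟨ cong (λ x → n₀ + (x + m₀)) (∑-cong (m+[n∸m]≡n ∘ m≤n)) ⟩
    n₀ + (∑ k (n ∘ F.suc) + m₀)                  ≡⟨ +-assoc n₀ _ m₀ ⟨
    n₀ + ∑ k (n ∘ F.suc) + m₀                    ≡⟨ +-comm _ m₀ ⟩
    m₀ + ∑ (suc k) n                             ∎
    where
    open ≡-Reasoning
    m₀ = m F.zero
    n₀ = n F.zero

  upper≡m₀+∑n : (∀ i → m (oppIdx i) ≤ n (F.suc i)) → ∑ (suc k) m + n F.zero + excess ≡ m F.zero + ∑ (suc k) n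
  upper≡m₀+∑n m≤n = trans (sym ∑width≡∑m+n₀+excess) (∑width≡m₀+∑n m≤n)

  upper≡lower : (∀ i → n (F.suc i) ≤ m (oppIdx i)) → ∑ (suc k) m + n F.zero + excess ≡ ∑ (suc k) m + n F.zero
  upper≡lower n≤m = trans (cong (∑ (suc k) m + n F.zero +_) (trans (∑-cong (m≤n⇒m∸n≡0 ∘ n≤m)) (∑-zero k)))
                          (+-identityʳ (∑ (suc k) m + n F.zero))

  label-colorable : 1 ≤ m F.zero → 1 ≤ n F.zero → Colorable (ChainAdj m n) (∑ (suc k) m + n F.zero + excess)
  label-colorable 1≤m₀ 1≤n₀ = label , label-L21 , subst (HasSpan label) ∑width≡∑m+n₀+excess (label-span 1≤m₀ 1≤n₀)

theorem4p3 : (k : ℕ) → (m n : Fin (suc k) → ℕ) →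
    (∀ i → 1 ≤ m i) → (∀ i → 1 ≤ n i) →
    ((Λ : ℕ) → IsLambda (ChainAdj m n) Λ →
       (∑ (suc k) m + n F.zero ≤ Λ) ×
       (Λ ≤ ∑ (suc k) m + n F.zero + ∑ k (λ i → n (F.suc i) ∸ m (oppIdx i)))) ×
    (Σ ℕ (λ Λ → IsLambda (ChainAdj m n) Λ)) ×
    ((∀ (i : Fin k) → m (oppIdx i) < n (F.suc i)) →
       IsLambda (ChainAdj m n) (∑ (suc k) m + n F.zero + ∑ k (λ i → n (F.suc i) ∸ m (oppIdx i)))) ×
    ((∀ (i : Fin k) → n (F.suc i) ≤ m (oppIdx i)) →
       IsLambda (ChainAdj m n) (∑ (suc k) m + n F.zero))
theorem4p3 k m n 1≤m 1≤n = bounds , lambda-exists colorable , upper-attained , lower-attained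
  where
  open ChainGraph m n
  open MinimalSpan (ChainAdj m n) adj? vertices↔ using (lambda-exists)

  colorable : Colorable (ChainAdj m n) (∑ (suc k) m + n F.zero + excess)
  colorable = label-colorable (1≤m F.zero) (1≤n F.zero)

  bounds : (Λ : ℕ) → IsLambda (ChainAdj m n) Λ →
           (∑ (suc k) m + n F.zero ≤ Λ) × (Λ ≤ ∑ (suc k) m + n F.zero + excess)
  bounds Λ isλ@((_ , l21 , span) , _) = span-≥-∑m+n₀ (1≤m F.zero) (1≤n F.zero) l21 span , IsLambda-≤ _ isλ colorable

  upper-attained : (∀ i → m (oppIdx i) < n (F.suc i)) → IsLambda (ChainAdj m n) (∑ (suc k) m + n F.zero + excess)
  upper-attained m<n = colorable , λ f s l21 span →
    subst (_≤ s) (sym (upper≡m₀+∑n (<⇒≤ ∘ m<n))) (span-≥-m₀+∑n (1≤m F.zero) (1≤n F.zero) l21 span)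

  lower-attained : (∀ i → n (F.suc i) ≤ m (oppIdx i)) → IsLambda (ChainAdj m n) (∑ (suc k) m + n F.zero)
  lower-attained n≤m = subst (Colorable (ChainAdj m n)) (upper≡lower n≤m) colorable ,
                       λ f s → span-≥-∑m+n₀ (1≤m F.zero) (1≤n F.zero)
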